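{- Let $k\ge2$, $\sigma\in\{+,-\}^k$, $n\ge1$ and $\pi=\pi_1\cdots\pi_n\in\mathfrak S_n$ with $\pi_n=1$. Suppose $\hat\pi^*\in\mathcal C^{\sigma,*}$ and $\pi$ satisfies condition $(\dagger)$: there exists a $*$-$\sigma$-segmentation $0=e_0\le\cdots\le e_k=n$ of $\hat\pi^*$ such that there is no integer $b\ge1$ with $n-2b\ge1$ for which both $\rho(\pi_{n-2b},\pi_{n-b},\pi_n)\in\{312,132\}$ and, for all $1\le i\le b$ and $0\le t\le k-1$, $e_t<\pi_{n-b-i}\le e_{t+1}$ iff $e_t<\pi_{n-i}\le e_{t+1}$. Then $\pi\in\mathcal A_n(\Sigma_\sigma)$.
   Context: Fix $k\ge2$ and $\sigma=\sigma_0\cdots\sigma_{k-1}\in\{+,-\}^k$; $T^-_\sigma=\{t:\sigma_t=-\}$. $\mathcal W_k$ is the set of infinite words $s_1s_2\cdots$ over $\{0,\dots,k-1\}$. Order $\prec_\sigma$: for $s\ne t$, with $j$ minimal such that $s_j\ne t_j$ and $c=|\{1\le i<j:s_i\in T^-_\sigma\}|$, $s\prec_\sigma t$ iff ($c$ even and $s_j<t_j$) or ($c$ odd and $s_j>t_j$). $\Sigma_\sigma(s_1s_2\cdots)=s_2s_3\cdots$. $\rho(x_1,\dots,x_n)$ is the permutation of $[n]$ in the same relative order as the distinct $x_i$. $\mathrm{Pat}(s,\Sigma_\sigma,n)=\rho(s,\Sigma_\sigma(s),\dots,\Sigma_\sigma^{n-1}(s))$ (w.r.t. $\prec_\sigma$)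 when these $n$ words are distinct, undefined otherwise; $\mathcal A_n(\Sigma_\sigma)$ is the set of defined such patterns. For $\pi\in\mathfrak S_n$, $\hat\pi$ is given by $\hat\pi_{\pi_i}=\pi_{i+1}$ ($\pi_{n+1}:=\pi_1$), and $\hat\pi^*$ is the one-line word of $\hat\pi$ with the entry equal to $\pi_1$ replaced by $*$. $\mathcal C_n^*$: words obtained from an $n$-cycle (in one-line notation) by replacing one entry by $*$. A $*$-$\sigma$-segmentation of $\tau^*=\tau^*_1\cdots\tau^*_n$ is $0=e_0\le\cdots\le e_k=n$ with: (a) for each $t$, the non-$*$ entries of $\tau^*_{e_t+1}\cdots\tau^*_{e_{t+1}}$ are increasing if $\sigma_t=+$, decreasing if $\sigma_t=-$; (b) if $\sigma_0=+$ and $\tau^*_1\tau^*_2=*1$ then $e_1\le1$; (c) if $\sigma_{k-1}=+$ and $\tau^*_{n-1}\tau^*_n=n*$ then $e_{k-1}\ge n-1$; (d) if $\sigma_0=\sigma_{k-1}=-$, $\tau^*_1=n$ and $\tau^*_{n-1}\tau^*_n=1*$ then $e_1=0$ or $e_{k-1}\ge n-1$; (e) if $\sigma_0=\sigma_{k-1}=-$, $\tau^*_n=1$ and $\tau^*_1\tau^*_2=*n$ then $e_{k-1}=n$ or $e_1\le1$. $\mathcal C^{\sigma,*}$ is the set of elements of $\bigcup_n\mathcal C^*_n$ admitting one. -}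

module Defs where

open import Data.Nat using (ℕ; zero; suc; _+_; _*_; _∸_; _≤_; _<_; _%_; _≡ᵇ_)
open import Data.Fin using (Fin; toℕ)
open import Data.Vec using (Vec; []; _∷_; lookup)
open import Data.Bool using (Bool; true; false; if_then_else_)
open import Data.Maybe using (Maybe; just; nothing)
open import Data.Product using (Σ; ∃; _×_; _,_)
open import Data.Sum using (_⊎_)
open import Function using (_∘_)
open import Relation.Nullary using (¬_)
open import Relation.Binary.PropositionalEquality using (_≡_; _≢_)

data Sign : Set where
  plus minus : Sign

-- σ_t for a natural index t (σ = σ_0 ⋯ σ_{k-1}); out-of-range default is
-- irrelevant (only used with t < k).
sig : ∀ {k} → Vec Sign k → ℕ → Sign
sig []      _       = plus
sig (x ∷ _) zero    = x
sig (_ ∷ σ) (suc t) = sig σ t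

-- Infinite words over {0,…,k-1}: s 0 s 1 s 2 ⋯ is s₁ s₂ s₃ ⋯

Word : ℕ → Set
Word k = ℕ → Fin k

shiftN : ∀ {k} → ℕ → Word k → Word k
shiftN m s i = s (m + i)

-- number of i < j with s_i ∈ T⁻_σ
negCount : ∀ {k} → Vec Sign k → Word k → ℕ → ℕ
negCount σ s zero    = zero
negCount σ s (suc j) with lookup σ (s j)
... | minus = suc (negCount σ s j)
... | plus  = negCount σ s j

_≺[_]_ : ∀ {k} → Word k → Vec Sign k → Word k → Set
s ≺[ σ ] t = ∃ λ j → (∀ i → i < j → s i ≡ t i) ×
  ((negCount σ s j % 2 ≡ 0 × toℕ (s j) < toℕ (t j)) ⊎
   (negCount σ s j % 2 ≡ 1 × toℕ (t j) < toℕ (s j)))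

-- Permutations of [n] = {1,…,n}, written as functions ℕ → ℕ
-- (π i = π_i for 1 ≤ i ≤ n; values outside [n] are irrelevant)

IsPerm : ℕ → (ℕ → ℕ) → Set
IsPerm n π = (∀ i → 1 ≤ i → i ≤ n → 1 ≤ π i × π i ≤ n) ×
             (∀ i j → 1 ≤ i → i ≤ n → 1 ≤ j → j ≤ n → π i ≡ π j → i ≡ j)

InA : ∀ {k} → Vec Sign k → (n : ℕ) → (ℕ → ℕ) → Set
InA {k} σ n π = Σ (Word k) λ s →
  (∀ i j → 1 ≤ i → i ≤ n → 1 ≤ j → j ≤ n → i ≢ j →
     ¬ (∀ m → shiftN (i ∸ 1) s m ≡ shiftN (j ∸ 1) s m)) ×
  (∀ i j → 1 ≤ i → i ≤ n → 1 ≤ j → j ≤ n →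
     (shiftN (i ∸ 1) s ≺[ σ ] shiftN (j ∸ 1) s → π i < π j) ×
     (π i < π j → shiftN (i ∸ 1) s ≺[ σ ] shiftN (j ∸ 1) s))

findPos : ℕ → (ℕ → ℕ) → ℕ → ℕ
findPos zero    π v = zero
findPos (suc m) π v = if π (suc m) ≡ᵇ v then suc m else findPos m π v

nextPos : ℕ → ℕ → ℕ
nextPos n i = if i ≡ᵇ n then 1 else suc i

hat : ℕ → (ℕ → ℕ) → ℕ → ℕ
hat n π v = π (nextPos n (findPos n π v))

-- star-words: nothing = *, just a = a
StarWord : Set
StarWord = ℕ → Maybe ℕ

hatStar : ℕ → (ℕ → ℕ) → StarWord
hatStar n π v = if hat n π v ≡ᵇ π 1 then nothing else just (hat n π v)

iter : (ℕ → ℕ) → ℕ → ℕ → ℕ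
iter f zero    x = x
iter f (suc m) x = f (iter f m x)

IsNCycle : ℕ → (ℕ → ℕ) → Set
IsNCycle n τ = IsPerm n τ × (∀ m → 1 ≤ m → m < n → iter τ m 1 ≢ 1)

InCstar : ℕ → StarWord → Set
InCstar n w = Σ (ℕ → ℕ) λ τ → IsNCycle n τ × Σ ℕ λ p →
  1 ≤ p × p ≤ n × w p ≡ nothing ×
  (∀ j → 1 ≤ j → j ≤ n → j ≢ p → w j ≡ just (τ j))

-- *-σ-segmentations  (e t = e_t for 0 ≤ t ≤ k)

IsStarSeg : ∀ {k} → Vec Sign k → (n : ℕ) → StarWord → (ℕ → ℕ) → Set
IsStarSeg {k} σ n w e =
  e 0 ≡ 0 × e k ≡ n × (∀ t → t < k → e t ≤ e (suc t)) ×
  -- (a)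
  (∀ t → t < k → ∀ p q a b → e t < p → p < q → q ≤ e (suc t) →
     w p ≡ just a → w q ≡ just b →
     (sig σ t ≡ plus → a < b) × (sig σ t ≡ minus → b < a)) ×
  -- (b)
  (sig σ 0 ≡ plus → 2 ≤ n → w 1 ≡ nothing → w 2 ≡ just 1 → e 1 ≤ 1) ×
  -- (c)
  (sig σ (k ∸ 1) ≡ plus → 2 ≤ n → w (n ∸ 1) ≡ just n → w n ≡ nothing →
     n ∸ 1 ≤ e (k ∸ 1)) ×
  -- (d)
  (sig σ 0 ≡ minus → sig σ (k ∸ 1) ≡ minus → 2 ≤ n →
     w 1 ≡ just n → w (n ∸ 1) ≡ just 1 → w n ≡ nothing →
     e 1 ≡ 0 ⊎ n ∸ 1 ≤ e (k ∸ 1)) ×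
  -- (e)
  (sig σ 0 ≡ minus → sig σ (k ∸ 1) ≡ minus → 2 ≤ n →
     w n ≡ just 1 → w 1 ≡ nothing → w 2 ≡ just n →
     e (k ∸ 1) ≡ n ⊎ e 1 ≤ 1)

InCσStar : ∀ {k} → Vec Sign k → (n : ℕ) → StarWord → Set
InCσStar σ n w = 1 ≤ n × InCstar n w × ∃ λ e → IsStarSeg σ n w e

rho312or132 : ℕ → ℕ → ℕ → Set
rho312or132 x y z = (y < z × z < x) ⊎ (x < z × z < y)

InBlock : (ℕ → ℕ) → ℕ → ℕ → Set
InBlock e t v = e t < v × v ≤ e (suc t)

Dagger : ∀ {k} → Vec Sign k → (n : ℕ) → (ℕ → ℕ) → Set
Dagger {k} σ n π = ∃ λ e → IsStarSeg σ n (hatStar n π) e ×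
  ¬ (∃ λ b → 1 ≤ b × suc (2 * b) ≤ n ×
       rho312or132 (π (n ∸ 2 * b)) (π (n ∸ b)) (π n) ×
       (∀ i → 1 ≤ i → i ≤ b → ∀ t → t < k →
          (InBlock e t (π (n ∸ b ∸ i)) → InBlock e t (π (n ∸ i))) ×
          (InBlock e t (π (n ∸ i)) → InBlock e t (π (n ∸ b ∸ i)))))

module Submission where

-- Write n = m + 1 and call t the letter of a value v ∈ [n] when
-- e_t < v ≤ e_{t+1}.  We realize π by the word  s = a_1 ⋯ a_m μ,  where a_i
-- is the letter of π_i and μ is the ≺σ-least infinite word: 0^∞, 0(k-1)^∞
-- or (0(k-1))^∞, according to σ_0 and σ_{k-1}.  The shift
-- Σ^m(s) = μ then sits below all others, as π_n = 1 does.
--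
-- Block letters
-- are compatible by condition (a) of the segmentation, because π̂* has its *
-- at position 1 and π̂*(π_i) = π_{i+1}; that μ lies below the shifts uses
-- conditions (b) and (e).

open import Defs
open import Data.Nat using (ℕ; zero; suc; _+_; _∸_; _≤_; _<_; _%_; _≡ᵇ_; z≤n; s≤s; _<?_; _≟_)
open import Data.Nat.Properties
open import Data.Fin using (Fin; toℕ; zero; suc; fromℕ; fromℕ<)
open import Data.Fin.Properties using (toℕ-injective; toℕ<n; toℕ-fromℕ; toℕ-fromℕ<)
  renaming (_≟_ to _≟ᶠ_)
open import Data.Vec using (Vec; _∷_; lookup)
open import Data.Bool using (if_then_else_)
open import Data.Maybe using (just; nothing)
open import Data.Product using (∃; _×_; _,_; proj₁; proj₂)
open import Data.Sum using (_⊎_; inj₁; inj₂; [_,_]′)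
open import Data.Empty using (⊥; ⊥-elim)
open import Function using (_∘_)
open import Relation.Nullary using (¬_; yes; no)
open import Relation.Nullary.Decidable using (dec-true; dec-false)
open import Relation.Binary using (tri<; tri≈; tri>)
open import Relation.Binary.PropositionalEquality

-- Parity alternates along ℕ; a minus letter flips the orientation of ≺σ.
parity-flip₀ : ∀ x → x % 2 ≡ 0 → suc x % 2 ≡ 1
parity-flip₀ zero          _ = refl
parity-flip₀ (suc zero)    ()
parity-flip₀ (suc (suc x)) p = parity-flip₀ x p

parity-flip₁ : ∀ x → x % 2 ≡ 1 → suc x % 2 ≡ 0
parity-flip₁ zero          ()
parity-flip₁ (suc zero)    _ = refl
parity-flip₁ (suc (suc x)) p = parity-flip₁ x p

if-≡ᵇ-true : ∀ {A : Set} {m n} {x y : A} → m ≡ n → (if m ≡ᵇ n then x else y) ≡ x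
if-≡ᵇ-true {m = m} {n} m≡n rewrite dec-true (m ≟ n) m≡n = refl

if-≡ᵇ-false : ∀ {A : Set} {m n} {x y : A} → ¬ m ≡ n → (if m ≡ᵇ n then x else y) ≡ y
if-≡ᵇ-false {m = m} {n} m≢n rewrite dec-false (m ≟ n) m≢n = refl

sig-lookup : ∀ {k} (σ : Vec Sign k) (f : Fin k) → sig σ (toℕ f) ≡ lookup σ f
sig-lookup (_ ∷ σ) zero    = refl
sig-lookup (_ ∷ σ) (suc f) = sig-lookup σ f

-- The order ≺σ on words

module Order {k : ℕ} (σ : Vec Sign k) where

  neg : Sign → ℕ
  neg plus  = 0
  neg minus = 1

  negCount-head : ∀ s j → negCount σ s (suc j) ≡ neg (lookup σ (s 0)) + negCount σ (shiftN 1 s) j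
  negCount-head s zero with lookup σ (s 0)
  ... | plus  = refl
  ... | minus = refl
  negCount-head s (suc j) with lookup σ (s (suc j))
  ... | plus  = negCount-head s j
  ... | minus = trans (cong suc (negCount-head s j))
                      (sym (+-suc (neg (lookup σ (s 0))) (negCount σ (shiftN 1 s) j)))

  negCount-last : ∀ s j → negCount σ s (suc j) ≡ neg (lookup σ (s j)) + negCount σ s j
  negCount-last s j with lookup σ (s j)
  ... | plus  = refl
  ... | minus = refl

  negCount-cong : ∀ s t j → (∀ i → i < j → s i ≡ t i) → negCount σ s j ≡ negCount σ t j
  negCount-cong s t zero    _ = refl
  negCount-cong s t (suc j) h = begin
    negCount σ s (suc j)                   ≡⟨ negCount-last s j ⟩
    neg (lookup σ (s j)) + negCount σ s j  ≡⟨ cong₂ (λ x y → neg (lookup σ x) + y) (h j ≤-refl)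
                                               (negCount-cong s t j (λ i i<j → h i (m<n⇒m<1+n i<j))) ⟩
    neg (lookup σ (t j)) + negCount σ t j  ≡⟨ negCount-last t j ⟨
    negCount σ t (suc j)                   ∎
    where open ≡-Reasoning

  Decides : Word k → Word k → ℕ → Set
  Decides s t j = (negCount σ s j % 2 ≡ 0 × toℕ (s j) < toℕ (t j)) ⊎
                  (negCount σ s j % 2 ≡ 1 × toℕ (t j) < toℕ (s j))

  decides-≢ : ∀ s t j → Decides s t j → s j ≢ t j
  decides-≢ _ _ _ (inj₁ (_ , lt)) eq = <-irrefl (cong toℕ eq) lt
  decides-≢ _ _ _ (inj₂ (_ , lt)) eq = <-irrefl (cong toℕ (sym eq)) lt

  ≺-cong : ∀ {s s′ t t′} → (∀ i → s i ≡ s′ i) → (∀ i → t i ≡ t′ i) →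
           s ≺[ σ ] t → s′ ≺[ σ ] t′
  ≺-cong {s} {s′} {t} {t′} s≈ t≈ (j , agree , dec) =
    j , (λ i i<j → trans (sym (s≈ i)) (trans (agree i i<j) (t≈ i))) , transport dec
    where
    parity : ∀ {r} → negCount σ s j % 2 ≡ r → negCount σ s′ j % 2 ≡ r
    parity = trans (cong (_% 2) (negCount-cong s′ s j (λ i _ → sym (s≈ i))))
    transport : Decides s t j → Decides s′ t′ j
    transport (inj₁ (p , lt)) = inj₁ (parity p , subst₂ (λ x y → toℕ x < toℕ y) (s≈ j) (t≈ j) lt)
    transport (inj₂ (p , lt)) = inj₂ (parity p , subst₂ (λ x y → toℕ x < toℕ y) (t≈ j) (s≈ j) lt)

  ≺⇒≢ : ∀ {s t} → s ≺[ σ ] t → ¬ (∀ i → s i ≡ t i)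
  ≺⇒≢ {s} {t} (j , _ , dec) s≈t = decides-≢ s t j dec (s≈t j)

  ≺-asym : ∀ {s t} → s ≺[ σ ] t → ¬ (t ≺[ σ ] s)
  ≺-asym {s} {t} (j , agree , dec) (j′ , agree′ , dec′) with <-cmp j j′
  ... | tri< j<j′ _ _ = decides-≢ s t j dec (sym (agree′ j j<j′))
  ... | tri> _ _ j′<j = decides-≢ t s j′ dec′ (sym (agree j′ j′<j))
  ... | tri≈ _ refl _ = opposite dec dec′
    where
    same-parity : negCount σ t j % 2 ≡ negCount σ s j % 2
    same-parity = cong (_% 2) (negCount-cong t s j agree′)
    opposite : Decides s t j → Decides t s j → ⊥
    opposite (inj₁ (_ , lt)) (inj₁ (_ , lt′)) = <-asym lt lt′
    opposite (inj₂ (_ , lt)) (inj₂ (_ , lt′)) = <-asym lt lt′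
    opposite (inj₁ (p , _)) (inj₂ (p′ , _)) with trans (sym p′) (trans same-parity p)
    ... | ()
    opposite (inj₂ (p , _)) (inj₁ (p′ , _)) with trans (sym p′) (trans same-parity p)
    ... | ()

  ≺-head : ∀ {s t} → toℕ (s 0) < toℕ (t 0) → s ≺[ σ ] t
  ≺-head lt = 0 , (λ _ ()) , inj₁ (refl , lt)

  ≺-plus : ∀ {s t} → s 0 ≡ t 0 → lookup σ (s 0) ≡ plus →
           shiftN 1 s ≺[ σ ] shiftN 1 t → s ≺[ σ ] t
  ≺-plus {s} {t} s0≡t0 sign (j , agree , dec) = suc j , agree′ , transport dec
    where
    agree′ : ∀ i → i < suc j → s i ≡ t i
    agree′ zero    _         = s0≡t0
    agree′ (suc i) (s≤s i<j) = agree i i<j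
    count : negCount σ s (suc j) ≡ negCount σ (shiftN 1 s) j
    count = trans (negCount-head s j) (cong (λ x → neg x + negCount σ (shiftN 1 s) j) sign)
    transport : Decides (shiftN 1 s) (shiftN 1 t) j → Decides s t (suc j)
    transport (inj₁ (p , lt)) = inj₁ (trans (cong (_% 2) count) p , lt)
    transport (inj₂ (p , lt)) = inj₂ (trans (cong (_% 2) count) p , lt)

  ≺-minus : ∀ {s t} → s 0 ≡ t 0 → lookup σ (s 0) ≡ minus →
            shiftN 1 t ≺[ σ ] shiftN 1 s → s ≺[ σ ] t
  ≺-minus {s} {t} s0≡t0 sign (j , agree , dec) = suc j , agree′ , transport dec
    where
    agree′ : ∀ i → i < suc j → s i ≡ t i
    agree′ zero    _         = s0≡t0
    agree′ (suc i) (s≤s i<j) = sym (agree i i<j)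
    c : ℕ
    c = negCount σ (shiftN 1 t) j
    count : negCount σ s (suc j) ≡ suc c
    count = trans (negCount-head s j)
              (trans (cong (λ x → neg x + negCount σ (shiftN 1 s) j) sign)
                (cong suc (negCount-cong (shiftN 1 s) (shiftN 1 t) j (λ i i<j → sym (agree i i<j)))))
    transport : Decides (shiftN 1 t) (shiftN 1 s) j → Decides s t (suc j)
    transport (inj₁ (p , lt)) = inj₂ (trans (cong (_% 2) count) (parity-flip₀ c p) , lt)
    transport (inj₂ (p , lt)) = inj₁ (trans (cong (_% 2) count) (parity-flip₁ c p) , lt)

  Minimal : Word k → Set
  Minimal μ = ∀ j → (negCount σ μ j % 2 ≡ 0 × (∀ f → f ≢ μ j → toℕ (μ j) < toℕ f)) ⊎
                    (negCount σ μ j % 2 ≡ 1 × (∀ f → f ≢ μ j → toℕ f < toℕ (μ j)))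

  first-difference : ∀ (μ t : Word k) i → t i ≢ μ i →
                     ∃ λ j → (∀ i′ → i′ < j → μ i′ ≡ t i′) × t j ≢ μ j
  first-difference μ t i t≢μ with scan (suc i)
    where
    scan : ∀ n → (∀ i′ → i′ < n → μ i′ ≡ t i′) ⊎ (∃ λ j → (∀ i′ → i′ < j → μ i′ ≡ t i′) × t j ≢ μ j)
    scan zero = inj₁ (λ _ ())
    scan (suc n) with scan n
    ... | inj₂ found = inj₂ found
    ... | inj₁ agree with t n ≟ᶠ μ n
    ...   | no  t≢μ′ = inj₂ (n , agree , t≢μ′)
    ...   | yes t≡μ  = inj₁ extend
      where
      extend : ∀ i′ → i′ < suc n → μ i′ ≡ t i′
      extend i′ i′<1+n with m<1+n⇒m<n∨m≡n i′<1+n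
      ... | inj₁ i′<n = agree i′ i′<n
      ... | inj₂ refl = sym t≡μ
  ... | inj₁ agree = ⊥-elim (t≢μ (sym (agree i ≤-refl)))
  ... | inj₂ found = found

  minimal-≺ : ∀ {μ} → Minimal μ → ∀ t i → t i ≢ μ i → μ ≺[ σ ] t
  minimal-≺ {μ} min t i t≢μ with first-difference μ t i t≢μ
  ... | j , agree , t≢μ′ with min j
  ...   | inj₁ (p , least) = j , agree , inj₁ (p , least (t j) t≢μ′)
  ...   | inj₂ (p , least) = j , agree , inj₂ (p , least (t j) t≢μ′)

-- A word realizes π as soon as π_i < π_j forces Σ^{i-1}(s) ≺σ Σ^{j-1}(s):
-- distinctness and the converse follow from asymmetry and injectivity of π.
realizes : ∀ {k} (σ : Vec Sign k) n π (s : Word k) → IsPerm n π →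
           (∀ i j → 1 ≤ i → i ≤ n → 1 ≤ j → j ≤ n → π i < π j →
              shiftN (i ∸ 1) s ≺[ σ ] shiftN (j ∸ 1) s) →
           InA σ n π
realizes σ n π s (_ , inj) ordered = s , distinct , λ i j a b c d → reflect i j a b c d , ordered i j a b c d
  where
  open Order σ
  distinct : ∀ i j → 1 ≤ i → i ≤ n → 1 ≤ j → j ≤ n → i ≢ j →
             ¬ (∀ r → shiftN (i ∸ 1) s r ≡ shiftN (j ∸ 1) s r)
  distinct i j a b c d i≢j same with <-cmp (π i) (π j)
  ... | tri< lt _ _ = ≺⇒≢ (ordered i j a b c d lt) same
  ... | tri≈ _ eq _ = i≢j (inj i j a b c d eq)
  ... | tri> _ _ gt = ≺⇒≢ (ordered j i c d a b gt) (λ r → sym (same r))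
  reflect : ∀ i j → 1 ≤ i → i ≤ n → 1 ≤ j → j ≤ n →
            shiftN (i ∸ 1) s ≺[ σ ] shiftN (j ∸ 1) s → π i < π j
  reflect i j a b c d below with <-cmp (π i) (π j)
  ... | tri< lt _ _ = lt
  ... | tri≈ _ eq _ with inj i j a b c d eq
  ...   | refl = ⊥-elim (≺-asym below below)
  reflect i j a b c d below | tri> _ _ gt = ⊥-elim (≺-asym below (ordered j i c d a b gt))

-- Realizing π by a prefix a_0 ⋯ a_{m-1} followed by a tail word μ; positions
-- are 0-based, a p being the letter placed for π_{p+1}.
module Realize {k : ℕ} (σ : Vec Sign k) (m : ℕ) (π : ℕ → ℕ)
  (perm : IsPerm (suc m) π) (π-last : π (suc m) ≡ 1) (a : ℕ → Fin k)
  (compatible : ∀ {p q} → p < m → q < m → π (suc p) < π (suc q) →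
     toℕ (a p) < toℕ (a q) ⊎
     (a p ≡ a q × (lookup σ (a p) ≡ plus  → π (2 + p) < π (2 + q))
                × (lookup σ (a p) ≡ minus → π (2 + q) < π (2 + p))))
  where
  open Order σ

  word : Word k → Word k
  word μ i with i <? m
  ... | yes _ = a i
  ... | no  _ = μ (i ∸ m)

  word-prefix : ∀ μ {i} → i < m → word μ i ≡ a i
  word-prefix μ {i} i<m with i <? m
  ... | yes _   = refl
  ... | no  i≮m = ⊥-elim (i≮m i<m)

  word-suffix : ∀ μ i → word μ (m + i) ≡ μ i
  word-suffix μ i with (m + i) <? m
  ... | yes m+i<m = ⊥-elim (m+n≮m m i m+i<m)
  ... | no  _     = cong μ (m+n∸m≡n m i)

  module _ (μ : Word k) (μ-below : ∀ q → q < m → μ ≺[ σ ] shiftN q (word μ)) where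

    head-shift : ∀ {p} → p < m → shiftN p (word μ) 0 ≡ a p
    head-shift {p} p<m = trans (cong (word μ) (+-identityʳ p)) (word-prefix μ p<m)

    tail-shift : ∀ p i → shiftN (suc p) (word μ) i ≡ shiftN 1 (shiftN p (word μ)) i
    tail-shift p i = cong (word μ) (sym (+-suc p i))

    step : ∀ {p q} → p < m → q < m → π (suc p) < π (suc q) →
           (π (2 + p) < π (2 + q) → shiftN (suc p) (word μ) ≺[ σ ] shiftN (suc q) (word μ)) →
           (π (2 + q) < π (2 + p) → shiftN (suc q) (word μ) ≺[ σ ] shiftN (suc p) (word μ)) →
           shiftN p (word μ) ≺[ σ ] shiftN q (word μ)
    step {p} {q} p<m q<m lt up down with compatible p<m q<m lt
    ... | inj₁ smaller =
      ≺-head (subst₂ (λ x y → toℕ x < toℕ y) (sym (head-shift p<m)) (sym (head-shift q<m)) smaller)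
    ... | inj₂ (same , plus-rule , minus-rule) = by-sign (lookup σ (a p)) refl
      where
      heads : shiftN p (word μ) 0 ≡ shiftN q (word μ) 0
      heads = trans (head-shift p<m) (trans same (sym (head-shift q<m)))
      sign-of : ∀ {x} → lookup σ (a p) ≡ x → lookup σ (shiftN p (word μ) 0) ≡ x
      sign-of = trans (cong (lookup σ) (head-shift p<m))
      by-sign : ∀ x → lookup σ (a p) ≡ x → shiftN p (word μ) ≺[ σ ] shiftN q (word μ)
      by-sign plus  sign = ≺-plus heads (sign-of sign)
                             (≺-cong (tail-shift p) (tail-shift q) (up (plus-rule sign)))
      by-sign minus sign = ≺-minus heads (sign-of sign)
                             (≺-cong (tail-shift q) (tail-shift p) (down (minus-rule sign)))

    -- the shifts Σ^p, p ≤ m, are ordered like π_{p+1}; induction on the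
    -- number f of letters still to be read before both reach μ
    chain : ∀ f {p q} → m ≤ f + p → m ≤ f + q → p ≤ m → q ≤ m → π (suc p) < π (suc q) →
            shiftN p (word μ) ≺[ σ ] shiftN q (word μ)
    chain zero {p} {q} m≤p m≤q p≤m q≤m lt =
      ⊥-elim (<-irrefl (cong (π ∘ suc) (trans (≤-antisym p≤m m≤p) (sym (≤-antisym q≤m m≤q)))) lt)
    chain (suc f) {p} {q} hp hq p≤m q≤m lt with m≤n⇒m<n∨m≡n p≤m | m≤n⇒m<n∨m≡n q≤m
    ... | inj₂ refl | inj₂ refl = ⊥-elim (<-irrefl refl lt)
    ... | inj₂ refl | inj₁ q<m  = ≺-cong (λ i → sym (word-suffix μ i)) (λ _ → refl) (μ-below q q<m)
    ... | inj₁ p<m  | inj₂ refl =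
      ⊥-elim (<⇒≱ (subst (π (suc p) <_) π-last lt) (proj₁ (proj₁ perm (suc p) (s≤s z≤n) (m≤n⇒m≤1+n p<m))))
    ... | inj₁ p<m  | inj₁ q<m  =
      step p<m q<m lt (chain f {suc p} {suc q} hp′ hq′ p<m q<m) (chain f {suc q} {suc p} hq′ hp′ q<m p<m)
      where
      hp′ : m ≤ f + suc p
      hp′ = subst (m ≤_) (sym (+-suc f p)) hp
      hq′ : m ≤ f + suc q
      hq′ = subst (m ≤_) (sym (+-suc f q)) hq

    realized : InA σ (suc m) π
    realized = realizes σ (suc m) π (word μ) perm ordered
      where
      ordered : ∀ i j → 1 ≤ i → i ≤ suc m → 1 ≤ j → j ≤ suc m → π i < π j →
                shiftN (i ∸ 1) (word μ) ≺[ σ ] shiftN (j ∸ 1) (word μ)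
      ordered (suc p) (suc q) _ (s≤s p≤m) _ (s≤s q≤m) =
        chain m (m≤m+n m p) (m≤m+n m q) p≤m q≤m

  word-end : ∀ μ {q d} → suc (q + d) ≡ m → word μ (q + suc d) ≡ μ 0
  word-end μ {q} {d} eq = trans (cong (word μ) (trans (+-suc q d) (trans eq (sym (+-identityʳ m)))))
                                (word-suffix μ 0)

  realized-by-minimal : ∀ μ → Minimal μ →
    (∀ q d → suc (q + d) ≡ m → ∃ λ i → word μ (q + i) ≢ μ i) → InA σ (suc m) π
  realized-by-minimal μ min leaves = realized μ below
    where
    below : ∀ q → q < m → μ ≺[ σ ] shiftN q (word μ)
    below q q<m with leaves q (m ∸ suc q) (m+[n∸m]≡n q<m)
    ... | i , differs = minimal-≺ min (shiftN q (word μ)) i differs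

-- Blocks of a segmentation 0 = e_0, …, e_K = n.  The block of v is the
-- largest t < K with e_t < v; no monotonicity of e is needed for it to
-- satisfy e_t < v ≤ e_{t+1}.
module Blocks (k′ n : ℕ) (e : ℕ → ℕ) (e0 : e 0 ≡ 0) (eK : e (suc k′) ≡ n) where

  blockUpTo : ℕ → ℕ → ℕ
  blockUpTo v zero = zero
  blockUpTo v (suc t) with e (suc t) <? v
  ... | yes _ = suc t
  ... | no  _ = blockUpTo v t

  blockUpTo-≤ : ∀ v t → blockUpTo v t ≤ t
  blockUpTo-≤ v zero = z≤n
  blockUpTo-≤ v (suc t) with e (suc t) <? v
  ... | yes _ = ≤-refl
  ... | no  _ = m≤n⇒m≤1+n (blockUpTo-≤ v t)

  blockUpTo-below : ∀ v t → 1 ≤ v → e (blockUpTo v t) < v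
  blockUpTo-below v zero 1≤v = subst (_< v) (sym e0) 1≤v
  blockUpTo-below v (suc t) 1≤v with e (suc t) <? v
  ... | yes lt = lt
  ... | no  _  = blockUpTo-below v t 1≤v

  blockUpTo-max : ∀ v t {t′} → t′ ≤ t → e t′ < v → t′ ≤ blockUpTo v t
  blockUpTo-max v zero    t′≤0 _ = t′≤0
  blockUpTo-max v (suc t) {t′} t′≤1+t lt with e (suc t) <? v
  ... | yes _ = t′≤1+t
  ... | no  ≮ with m≤n⇒m<n∨m≡n t′≤1+t
  ...   | inj₁ (s≤s t′≤t) = blockUpTo-max v t t′≤t lt
  ...   | inj₂ refl       = ⊥-elim (≮ lt)

  block : ℕ → ℕ
  block v = blockUpTo v k′

  block<K : ∀ v → block v < suc k′
  block<K v = s≤s (blockUpTo-≤ v k′)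

  block-spec : ∀ {v} → 1 ≤ v → v ≤ n → InBlock e (block v) v
  block-spec {v} 1≤v v≤n = blockUpTo-below v k′ 1≤v , above
    where
    above : v ≤ e (suc (block v))
    above with m≤n⇒m<n∨m≡n (blockUpTo-≤ v k′)
    ... | inj₂ b≡k′ = subst (λ t → v ≤ e (suc t)) (sym b≡k′) (subst (v ≤_) (sym eK) v≤n)
    ... | inj₁ b<k′ = ≮⇒≥ λ lt → <-irrefl refl (blockUpTo-max v k′ b<k′ lt)

  block-mono : ∀ {v v′} → 1 ≤ v → v ≤ v′ → block v ≤ block v′
  block-mono {v} 1≤v v≤v′ =
    blockUpTo-max _ k′ (blockUpTo-≤ v k′) (<-≤-trans (blockUpTo-below v k′ 1≤v) v≤v′)

module Hat (m : ℕ) (π : ℕ → ℕ) (perm : IsPerm (suc m) π) (π-last : π (suc m) ≡ 1) where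

  private
    n : ℕ
    n = suc m
    inj : ∀ i j → 1 ≤ i → i ≤ n → 1 ≤ j → j ≤ n → π i ≡ π j → i ≡ j
    inj = proj₂ perm

  -- π is injective, so the search for the value π_i stops at position i
  findPos-π : ∀ j i → 1 ≤ i → i ≤ j → j ≤ n → findPos j π (π i) ≡ i
  findPos-π zero    i 1≤i i≤0 _ = ⊥-elim (<⇒≱ 1≤i i≤0)
  findPos-π (suc j) i 1≤i i≤1+j 1+j≤n with m≤n⇒m<n∨m≡n i≤1+j
  ... | inj₂ refl       = if-≡ᵇ-true {m = π (suc j)} refl
  ... | inj₁ (s≤s i≤j) =
    trans (if-≡ᵇ-false {m = π (suc j)} {π i} λ eq →
             <-irrefl (sym (inj _ _ (s≤s z≤n) 1+j≤n 1≤i (≤-trans i≤1+j 1+j≤n) eq)) (s≤s i≤j))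
          (findPos-π j i 1≤i i≤j (≤-trans (n≤1+n j) 1+j≤n))

  hat-π : ∀ i → 1 ≤ i → i < n → hat n π (π i) ≡ π (suc i)
  hat-π i 1≤i i<n = cong π (trans (cong (nextPos n) (findPos-π n i 1≤i (<⇒≤ i<n) ≤-refl))
                                  (if-≡ᵇ-false {m = i} {n} (<⇒≢ i<n)))

  hat-1 : hat n π 1 ≡ π 1
  hat-1 = cong π (begin
    nextPos n (findPos n π 1)     ≡⟨ cong (λ v → nextPos n (findPos n π v)) (sym π-last) ⟩
    nextPos n (findPos n π (π n)) ≡⟨ cong (nextPos n) (findPos-π n n (s≤s z≤n) ≤-refl ≤-refl) ⟩
    nextPos n n                   ≡⟨ if-≡ᵇ-true {m = n} refl ⟩
    1                             ∎)
    where open ≡-Reasoning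

  star-at-1 : hatStar n π 1 ≡ nothing
  star-at-1 = trans (cong (λ x → if x ≡ᵇ π 1 then nothing else just x) hat-1) (if-≡ᵇ-true {m = π 1} refl)

  hatStar-π : ∀ i → 1 ≤ i → i < n → hatStar n π (π i) ≡ just (π (suc i))
  hatStar-π i 1≤i i<n = trans (if-≡ᵇ-false not-first) (cong just (hat-π i 1≤i i<n))
    where
    not-first : hat n π (π i) ≢ π 1
    not-first eq with inj (suc i) 1 (s≤s z≤n) i<n (s≤s z≤n) (s≤s z≤n) (trans (sym (hat-π i 1≤i i<n)) eq)
    ... | refl = <-irrefl refl 1≤i

star-word-values : ∀ {n w} → InCstar n w → w 1 ≡ nothing →
                   ∀ j → 2 ≤ j → j ≤ n → ∃ λ v → 1 ≤ v × v ≤ n × w j ≡ just v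
star-word-values {n} {w} (τ , ((τ-range , _) , _) , p , _ , _ , _ , entries) w1 j 2≤j j≤n = at-j
  where
  1≤j : 1 ≤ j
  1≤j = ≤-trans (n≤1+n 1) 2≤j
  at-j : ∃ λ v → 1 ≤ v × v ≤ n × w j ≡ just v
  at-j with p ≟ 1
  ... | yes refl = τ j , proj₁ (τ-range j 1≤j j≤n) , proj₂ (τ-range j 1≤j j≤n) ,
                   entries j 1≤j j≤n λ { refl → <-irrefl refl 2≤j }
  ... | no p≢1 with trans (sym w1) (entries 1 ≤-refl (≤-trans 1≤j j≤n) (λ eq → p≢1 (sym eq)))
  ...   | ()

-- The three minimal tail words over {0, …, K-1}, K = k₂ + 2

module Tails (k₂ : ℕ) (σ : Vec Sign (suc (suc k₂))) where
  open Order σ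

  last : Fin (suc (suc k₂))
  last = fromℕ (suc k₂)

  zero≢last : zero ≢ last
  zero≢last ()

  above-zero : ∀ (f : Fin (suc (suc k₂))) → f ≢ zero → 0 < toℕ f
  above-zero zero    f≢0 = ⊥-elim (f≢0 refl)
  above-zero (suc f) _   = s≤s z≤n

  below-last : ∀ (f : Fin (suc (suc k₂))) → f ≢ last → toℕ f < toℕ last
  below-last f f≢last = subst (toℕ f <_) (sym (toℕ-fromℕ (suc k₂)))
    (≤∧≢⇒< (≤-pred (toℕ<n f)) λ eq → f≢last (toℕ-injective (trans eq (sym (toℕ-fromℕ (suc k₂))))))

  zeros : Word (suc (suc k₂))
  zeros _ = zero

  zeros-minimal : lookup σ zero ≡ plus → Minimal zeros
  zeros-minimal sign j = inj₁ (cong (_% 2) (count j) , λ f f≢0 → above-zero f f≢0)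
    where
    count : ∀ j → negCount σ zeros j ≡ 0
    count zero = refl
    count (suc j) rewrite sign = count j

  zero-lasts : Word (suc (suc k₂))
  zero-lasts zero    = zero
  zero-lasts (suc _) = last

  zero-lasts-minimal : lookup σ zero ≡ minus → lookup σ last ≡ plus → Minimal zero-lasts
  zero-lasts-minimal sign₀ sign₁ zero    = inj₁ (refl , above-zero)
  zero-lasts-minimal sign₀ sign₁ (suc j) = inj₂ (cong (_% 2) (count j) , below-last)
    where
    count : ∀ j → negCount σ zero-lasts (suc j) ≡ 1
    count zero rewrite sign₀ = refl
    count (suc j) rewrite sign₁ = count j

  alternating : Word (suc (suc k₂))
  alternating zero          = zero
  alternating (suc zero)    = last
  alternating (suc (suc i)) = alternating i

  alternating-parity : ∀ j → (j % 2 ≡ 0 × alternating j ≡ zero) ⊎ (j % 2 ≡ 1 × alternating j ≡ last)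
  alternating-parity zero          = inj₁ (refl , refl)
  alternating-parity (suc zero)    = inj₂ (refl , refl)
  alternating-parity (suc (suc j)) = alternating-parity j

  alternating-step : ∀ d → alternating d ≡ zero → alternating (suc d) ≡ last
  alternating-step zero          _  = refl
  alternating-step (suc zero)    ()
  alternating-step (suc (suc d)) at0 = alternating-step d at0

  alternating-minus : lookup σ zero ≡ minus → lookup σ last ≡ minus →
                      ∀ j → lookup σ (alternating j) ≡ minus
  alternating-minus sign₀ sign₁ j with alternating-parity j
  ... | inj₁ (_ , at0) = trans (cong (lookup σ) at0) sign₀
  ... | inj₂ (_ , at1) = trans (cong (lookup σ) at1) sign₁

  alternating-count : lookup σ zero ≡ minus → lookup σ last ≡ minus →
                      ∀ j → negCount σ alternating j ≡ j
  alternating-count sign₀ sign₁ zero = refl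
  alternating-count sign₀ sign₁ (suc j) rewrite alternating-minus sign₀ sign₁ j =
    cong suc (alternating-count sign₀ sign₁ j)

  alternating-minimal : lookup σ zero ≡ minus → lookup σ last ≡ minus → Minimal alternating
  alternating-minimal sign₀ sign₁ j with alternating-parity j
  ... | inj₁ (even , at0) = inj₁ (trans (cong (_% 2) count) even ,
          λ f f≢ → subst (λ x → toℕ x < toℕ f) (sym at0) (above-zero f (λ eq → f≢ (trans eq (sym at0)))))
    where
    count : negCount σ alternating j ≡ j
    count = alternating-count sign₀ sign₁ j
  ... | inj₂ (odd , at1) = inj₂ (trans (cong (_% 2) count) odd ,
          λ f f≢ → subst (λ x → toℕ f < toℕ x) (sym at1) (below-last f (λ eq → f≢ (trans eq (sym at1)))))
    where
    count : negCount σ alternating j ≡ j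
    count = alternating-count sign₀ sign₁ j

module Proof (k₂ : ℕ) (σ : Vec Sign (suc (suc k₂))) (m : ℕ) (π : ℕ → ℕ)
  (perm : IsPerm (suc m) π) (π-last : π (suc m) ≡ 1)
  (cycle : InCstar (suc m) (hatStar (suc m) π))
  (e : ℕ → ℕ) (e0 : e 0 ≡ 0) (eK : e (suc (suc k₂)) ≡ suc m)
  (seg-a : ∀ t → t < suc (suc k₂) → ∀ p q a b → e t < p → p < q → q ≤ e (suc t) →
           hatStar (suc m) π p ≡ just a → hatStar (suc m) π q ≡ just b →
           (sig σ t ≡ plus → a < b) × (sig σ t ≡ minus → b < a))
  (seg-b : sig σ 0 ≡ plus → 2 ≤ suc m → hatStar (suc m) π 1 ≡ nothing →
           hatStar (suc m) π 2 ≡ just 1 → e 1 ≤ 1)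
  (seg-e : sig σ 0 ≡ minus → sig σ (suc k₂) ≡ minus → 2 ≤ suc m →
           hatStar (suc m) π (suc m) ≡ just 1 → hatStar (suc m) π 1 ≡ nothing →
           hatStar (suc m) π 2 ≡ just (suc m) → e (suc k₂) ≡ suc m ⊎ e 1 ≤ 1)
  where

  private
    n : ℕ
    n = suc m
    w : StarWord
    w = hatStar n π

  open Blocks (suc k₂) n e e0 eK
  open Hat m π perm π-last
  open Tails k₂ σ
  open Order σ

  range : ∀ {i} → 1 ≤ i → i ≤ n → 1 ≤ π i × π i ≤ n
  range = proj₁ perm _

  above-1 : ∀ {i} → 1 ≤ i → i < n → 2 ≤ π i
  above-1 {i} 1≤i i<n = ≤∧≢⇒< (proj₁ (range 1≤i (<⇒≤ i<n))) λ 1≡πi →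
    <-irrefl (proj₂ perm i n 1≤i (<⇒≤ i<n) (s≤s z≤n) ≤-refl (trans (sym 1≡πi) (sym π-last))) i<n

  hatStar-to-1 : ∀ j → suc j ≡ m → w (π (suc j)) ≡ just 1
  hatStar-to-1 j refl = trans (hatStar-π (suc j) (s≤s z≤n) ≤-refl) (cong just π-last)

  in-block : ∀ {i} → 1 ≤ i → i ≤ n → InBlock e (block (π i)) (π i)
  in-block 1≤i i≤n = block-spec (proj₁ (range 1≤i i≤n)) (proj₂ (range 1≤i i≤n))

  letter : ℕ → Fin (suc (suc k₂))
  letter v = fromℕ< (block<K v)

  toℕ-letter : ∀ v → toℕ (letter v) ≡ block v
  toℕ-letter v = toℕ-fromℕ< (block<K v)

  sign-letter : ∀ v → lookup σ (letter v) ≡ sig σ (block v)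
  sign-letter v = trans (sym (sig-lookup σ (letter v))) (cong (sig σ) (toℕ-letter v))

  sig-first : sig σ 0 ≡ lookup σ zero
  sig-first = sig-lookup σ zero

  sig-last : sig σ (suc k₂) ≡ lookup σ last
  sig-last = trans (cong (sig σ) (sym (toℕ-fromℕ (suc k₂)))) (sig-lookup σ last)

  letter-zero : ∀ {v} → letter v ≡ zero → block v ≡ 0
  letter-zero {v} eq = trans (sym (toℕ-letter v)) (cong toℕ eq)

  letter-last : ∀ {v} → letter v ≡ last → block v ≡ suc k₂
  letter-last {v} eq = trans (sym (toℕ-letter v)) (trans (cong toℕ eq) (toℕ-fromℕ (suc k₂)))

  prefix : ℕ → Fin (suc (suc k₂))
  prefix p = letter (π (suc p))

  compatible : ∀ {p q} → p < m → q < m → π (suc p) < π (suc q) →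
     toℕ (prefix p) < toℕ (prefix q) ⊎
     (prefix p ≡ prefix q × (lookup σ (prefix p) ≡ plus  → π (2 + p) < π (2 + q))
                          × (lookup σ (prefix p) ≡ minus → π (2 + q) < π (2 + p)))
  compatible {p} {q} p<m q<m lt
    with m≤n⇒m<n∨m≡n (block-mono (proj₁ (range {suc p} (s≤s z≤n) (m≤n⇒m≤1+n p<m))) (<⇒≤ lt))
  ... | inj₁ b<b′ = inj₁ (subst₂ _<_ (sym (toℕ-letter (π (suc p)))) (sym (toℕ-letter (π (suc q)))) b<b′)
  ... | inj₂ b≡b′ = inj₂ (toℕ-injective (trans (toℕ-letter v) (trans b≡b′ (sym (toℕ-letter v′)))) ,
                          (λ sign → proj₁ rule (trans (sym (sign-letter v)) sign)) ,
                          (λ sign → proj₂ rule (trans (sym (sign-letter v)) sign)))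
    where
    v v′ : ℕ
    v = π (suc p)
    v′ = π (suc q)
    rule : (sig σ (block v) ≡ plus  → π (2 + p) < π (2 + q)) ×
           (sig σ (block v) ≡ minus → π (2 + q) < π (2 + p))
    rule = seg-a (block v) (block<K v) v v′ (π (2 + p)) (π (2 + q))
             (proj₁ (in-block (s≤s z≤n) (m≤n⇒m≤1+n p<m))) lt
             (subst (λ t → v′ ≤ e (suc t)) (sym b≡b′) (proj₂ (in-block (s≤s z≤n) (m≤n⇒m≤1+n q<m))))
             (hatStar-π (suc p) (s≤s z≤n) (s≤s p<m)) (hatStar-π (suc q) (s≤s z≤n) (s≤s q<m))

  first-block : ∀ {i} → 1 ≤ i → i ≤ n → letter (π i) ≡ zero → π i ≤ e 1
  first-block {i} 1≤i i≤n at-0 = subst (λ t → π i ≤ e (suc t)) (letter-zero {π i} at-0)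
                                   (proj₂ (in-block 1≤i i≤n))

  last-block : ∀ {i} → 1 ≤ i → i ≤ n → letter (π i) ≡ last → e (suc k₂) < π i
  last-block {i} 1≤i i≤n at-K = subst (λ t → e t < π i) (letter-last {π i} at-K)
                                  (proj₁ (in-block 1≤i i≤n))

  penultimate-not-first : lookup σ zero ≡ plus → ∀ j → suc j ≡ m → prefix j ≢ zero
  penultimate-not-first sign j refl at-0
    with m≤n⇒m<n∨m≡n (above-1 {suc j} (s≤s z≤n) ≤-refl)
  ... | inj₂ 2≡v = <-irrefl refl (≤-<-trans (≤-trans (≤-reflexive 2≡v) (first-block (s≤s z≤n) (n≤1+n _) at-0))
                     (s≤s (seg-b (trans sig-first sign) (s≤s (s≤s z≤n)) star-at-1
                             (subst (λ x → w x ≡ just 1) (sym 2≡v) (hatStar-to-1 j refl)))))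
  ... | inj₁ 2<v with star-word-values cycle star-at-1 2 ≤-refl (s≤s (s≤s z≤n))
  ...   | x , 1≤x , _ , w2 = <-irrefl refl (≤-<-trans 1≤x (proj₁ rule (trans sig-first sign)))
    where
    rule : (sig σ 0 ≡ plus → x < 1) × (sig σ 0 ≡ minus → 1 < x)
    rule = seg-a 0 (s≤s z≤n) 2 (π (suc j)) x 1 (subst (_< 2) (sym e0) (s≤s z≤n)) 2<v
             (first-block (s≤s z≤n) (n≤1+n _) at-0) w2 (hatStar-to-1 j refl)

  -- with σ_{K-1} = −, a last-block value sent to 1 by π̂* must be n itself:
  -- otherwise π̂*_n, also in the last block, would have to be below 1
  last-block-to-1 : lookup σ last ≡ minus → ∀ j → suc j ≡ m → prefix j ≡ last → π (suc j) ≡ n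
  last-block-to-1 sign j refl at-K with m≤n⇒m<n∨m≡n (proj₂ (range {suc j} (s≤s z≤n) (n≤1+n _)))
  ... | inj₂ v≡n = v≡n
  ... | inj₁ v<n with star-word-values cycle star-at-1 n (s≤s (s≤s z≤n)) ≤-refl
  ...   | x , 1≤x , _ , wn = ⊥-elim (<-irrefl refl (≤-<-trans 1≤x (proj₂ rule (trans sig-last sign))))
    where
    rule : (sig σ (suc k₂) ≡ plus → 1 < x) × (sig σ (suc k₂) ≡ minus → x < 1)
    rule = seg-a (suc k₂) ≤-refl (π (suc j)) n 1 x (last-block (s≤s z≤n) (n≤1+n _) at-K) v<n
             (≤-reflexive (sym eK)) (hatStar-to-1 j refl) wn

  hatStar-to-n : lookup σ last ≡ minus → ∀ j → suc (suc j) ≡ m → prefix (suc j) ≡ last →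
                 w (π (suc j)) ≡ just n
  hatStar-to-n sign j refl at-K = trans (hatStar-π (suc j) (s≤s z≤n) (s≤s (n≤1+n _)))
                                        (cong just (last-block-to-1 sign (suc j) refl at-K))

  prefix-not-zero-last : lookup σ zero ≡ minus → lookup σ last ≡ minus →
                         ∀ j → suc (suc j) ≡ m → prefix j ≡ zero → prefix (suc j) ≢ last
  prefix-not-zero-last sign₀ sign₁ j refl at-0 at-K
    with m≤n⇒m<n∨m≡n (above-1 {suc j} (s≤s z≤n) (s≤s (n≤1+n _)))
  ... | inj₂ 2≡v = [ (λ eK-1≡n → <-irrefl (trans eK-1≡n (sym n-last)) (last-block (s≤s z≤n) (n≤1+n _) at-K))
                   , (λ e₁≤1 → <-irrefl refl (≤-<-trans 2≤e₁ (s≤s e₁≤1))) ]′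
                   (seg-e (trans sig-first sign₀) (trans sig-last sign₁) (s≤s (s≤s z≤n))
                          n-to-1 star-at-1 (subst (λ x → w x ≡ just n) (sym 2≡v) (hatStar-to-n sign₁ j refl at-K)))
    where
    n-last : π (suc (suc j)) ≡ n
    n-last = last-block-to-1 sign₁ (suc j) refl at-K
    n-to-1 : w n ≡ just 1
    n-to-1 = subst (λ x → w x ≡ just 1) n-last (hatStar-to-1 (suc j) refl)
    2≤e₁ : 2 ≤ e 1
    2≤e₁ = ≤-trans (≤-reflexive 2≡v) (first-block (s≤s z≤n) (≤-trans (n≤1+n _) (n≤1+n _)) at-0)
  ... | inj₁ 2<v with star-word-values cycle star-at-1 2 ≤-refl (s≤s (s≤s z≤n))
  ...   | x , _ , x≤n , w2 = <-irrefl refl (≤-<-trans x≤n (proj₂ rule (trans sig-first sign₀)))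
    where
    rule : (sig σ 0 ≡ plus → x < n) × (sig σ 0 ≡ minus → n < x)
    rule = seg-a 0 (s≤s z≤n) 2 (π (suc j)) x n (subst (_< 2) (sym e0) (s≤s z≤n)) 2<v
             (first-block (s≤s z≤n) (≤-trans (n≤1+n _) (n≤1+n _)) at-0) w2 (hatStar-to-n sign₁ j refl at-K)

  open Realize σ m π perm π-last prefix compatible

  -- σ_0 = +: the tail 0^∞, left by each shift at the letter of π_{n-1}
  realized-plus : lookup σ zero ≡ plus → InA σ n π
  realized-plus sign = realized-by-minimal zeros (zeros-minimal sign) leaves
    where
    leaves : ∀ q d → suc (q + d) ≡ m → ∃ λ i → word zeros (q + i) ≢ zeros i
    leaves q d eq = d , λ at-0 → penultimate-not-first sign (q + d) eq
                                   (trans (sym (word-prefix zeros (≤-reflexive eq))) at-0)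

  -- σ_0 = −, σ_{K-1} = +: the tail 0 (K-1)^∞, left by each shift where μ restarts
  realized-minus-plus : lookup σ zero ≡ minus → lookup σ last ≡ plus → InA σ n π
  realized-minus-plus sign₀ sign₁ = realized-by-minimal zero-lasts (zero-lasts-minimal sign₀ sign₁)
    λ q d eq → suc d , λ at-K → zero≢last (trans (sym (word-end zero-lasts eq)) at-K)

  -- σ_0 = σ_{K-1} = −: the tail (0 (K-1))^∞; a shift of odd offset is left where
  -- μ restarts, one of even offset at the last two prefix letters, by (e)
  alternating-leaves : lookup σ zero ≡ minus → lookup σ last ≡ minus →
                       ∀ q d → suc (q + d) ≡ m → ∃ λ i → word alternating (q + i) ≢ alternating i
  alternating-leaves sign₀ sign₁ q zero eq =
    1 , λ at-K → zero≢last (trans (sym (word-end alternating eq)) at-K)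
  alternating-leaves sign₀ sign₁ q (suc d) eq with alternating-parity d
  ... | inj₂ (_ , at1) =
    suc (suc d) , λ x → zero≢last (trans (sym (word-end alternating eq)) (trans x at1))
  ... | inj₁ (_ , at0) with prefix (q + suc d) ≟ᶠ last
  ...   | no ≢last = suc d , λ x → ≢last (trans (sym (word-prefix alternating (≤-reflexive eq)))
                                         (trans x (alternating-step d at0)))
  ...   | yes ≡last with prefix (q + d) ≟ᶠ zero
  ...     | no ≢zero = d , λ x → ≢zero (trans (sym (word-prefix alternating q+d<m)) (trans x at0))
    where
    q+d<m : q + d < m
    q+d<m = subst (suc (q + d) ≤_) eq (s≤s (+-monoʳ-≤ q (n≤1+n d)))
  ...     | yes ≡zero = ⊥-elim (prefix-not-zero-last sign₀ sign₁ (q + d)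
                          (trans (cong suc (sym (+-suc q d))) eq) ≡zero
                          (subst (λ i → prefix i ≡ last) (+-suc q d) ≡last))

  realized-minus-minus : lookup σ zero ≡ minus → lookup σ last ≡ minus → InA σ n π
  realized-minus-minus sign₀ sign₁ =
    realized-by-minimal alternating (alternating-minimal sign₀ sign₁) (alternating-leaves sign₀ sign₁)

  π-realized : InA σ n π
  π-realized with lookup σ zero in sign₀ | lookup σ last in sign₁
  ... | plus  | _     = realized-plus sign₀
  ... | minus | plus  = realized-minus-plus sign₀ sign₁
  ... | minus | minus = realized-minus-minus sign₀ sign₁

lemma2p4 : (k : ℕ) → 2 ≤ k → (σ : Vec Sign k) → (n : ℕ) → 1 ≤ n →
    (π : ℕ → ℕ) → IsPerm n π → π n ≡ 1 →
    InCσStar σ n (hatStar n π) → Dagger σ n π → InA σ n π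
lemma2p4 (suc (suc k₂)) (s≤s (s≤s z≤n)) σ (suc m) (s≤s z≤n) π perm π-last
         (_ , cycle , _) (e , (e0 , eK , _ , seg-a , seg-b , _ , _ , seg-e) , _) =
  Proof.π-realized k₂ σ m π perm π-last cycle e e0 eK seg-a seg-b seg-e
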